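{- Let $A$ be the set of cyclic Carlitz compositions, i.e., nonempty finite sequences $(a_1,\ldots,a_l)$ of positive integers with $a_j\ne a_{j+1}$ for $1\le j<l$ and, when $l\ge2$, $a_l\ne a_1$; for $W=(a_1,\ldots,a_l)$ let $\mathrm{sum}(W)=a_1+\cdots+a_l$. Then \[ \sum_{W\in A}x^{\mathrm{sum}(W)}=\frac{\sum_{i=1}^\infty\frac{x^i}{(1+x^i)^2}}{1-\sum_{i=1}^\infty\frac{x^i}{1+x^i}}+\sum_{i=1}^\infty\frac{x^{2i}}{1+x^i}. \] -}

module Defs where

open import Data.Nat as ℕ using (ℕ; zero; suc; _∸_; _<_; _≡ᵇ_)
open import Data.Integer as ℤ using (ℤ; +_; 0ℤ; 1ℤ; -_) renaming (_+_ to _+ℤ_; _*_ to _*ℤ_)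
open import Data.Bool using (if_then_else_)
open import Data.List using (List; []; _∷_)
open import Data.List.Relation.Unary.All using (All)
open import Data.List.Relation.Unary.Linked using (Linked)
open import Data.Unit using (⊤)
open import Data.Empty using (⊥)
open import Data.Product using (_×_)
open import Relation.Binary.PropositionalEquality using (_≢_)

lastOf : ℕ → List ℕ → ℕ
lastOf a []      = a
lastOf a (b ∷ r) = lastOf b r

NonEmpty : List ℕ → Set
NonEmpty []      = ⊥
NonEmpty (_ ∷ _) = ⊤

CyclicEnd : List ℕ → Set
CyclicEnd []          = ⊤
CyclicEnd (a ∷ [])    = ⊤
CyclicEnd (a ∷ b ∷ r) = lastOf b r ≢ a

CyclicCarlitz : List ℕ → Set
CyclicCarlitz W = NonEmpty W × All (0 <_) W × Linked _≢_ W × CyclicEnd W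

FPS : Set
FPS = ℕ → ℤ

Σ0to : ℕ → (ℕ → ℤ) → ℤ
Σ0to zero    f = f 0
Σ0to (suc n) f = Σ0to n f +ℤ f (suc n)

Σ1to : ℕ → (ℕ → ℤ) → ℤ
Σ1to zero    f = 0ℤ
Σ1to (suc n) f = Σ1to n f +ℤ f (suc n)

oneS : FPS
oneS n = if n ≡ᵇ 0 then 1ℤ else 0ℤ

X^ : ℕ → FPS
X^ i n = if n ≡ᵇ i then 1ℤ else 0ℤ

_⊕_ : FPS → FPS → FPS
(f ⊕ g) n = f n +ℤ g n

⊖_ : FPS → FPS
(⊖ f) n = - f n

_⊗_ : FPS → FPS → FPS
(f ⊗ g) n = Σ0to n (λ k → f k *ℤ g (n ∸ k))

infixl 6 _⊕_
infixl 7 _⊗_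

_^S_ : FPS → ℕ → FPS
h ^S zero    = oneS
h ^S suc k   = h ⊗ (h ^S k)

-- 1/(1 - h) = Σ_k h^k, for h with zero constant term
-- (then h^k has order ≥ k, so coefficient n only involves k ≤ n)
inv1m : FPS → FPS
inv1m h n = Σ0to n (λ k → (h ^S k) n)

-- multiplicative inverse of f with constant term 1: 1/f = 1/(1 - (1 - f))
invS : FPS → FPS
invS f = inv1m (oneS ⊕ ⊖ f)

-- Σ_{i ≥ 1} F i, for a family where F i has order ≥ i
-- (so coefficient n only involves i ≤ n)
ΣS≥1 : (ℕ → FPS) → FPS
ΣS≥1 F n = Σ1to n (λ i → F i n)

numerS : FPS
numerS = ΣS≥1 (λ i → X^ i ⊗ invS ((oneS ⊕ X^ i) ⊗ (oneS ⊕ X^ i)))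

denomSumS : FPS
denomSumS = ΣS≥1 (λ i → X^ i ⊗ invS (oneS ⊕ X^ i))

extraS : FPS
extraS = ΣS≥1 (λ i → X^ (i ℕ.+ i) ⊗ invS (oneS ⊕ X^ i))

rhsS : FPS
rhsS = numerS ⊗ invS (oneS ⊕ ⊖ denomSumS) ⊕ extraS

-- Write A i = x^i/(1+x^i), D = Σ_{i≥1} A i and C = 1/(1 − D). Deleting the first part j of a Carlitz
-- composition leaves either nothing or a Carlitz composition not starting with j. So if T counts the
-- nonempty Carlitz compositions whose last part satisfies Q, and F j those among them starting with j,
-- then F j = x^j (⟦Q j⟧ + T − F j), whence F j = A j (⟦Q j⟧ + T) and, summing over j,
-- T = C Σ_j A j ⟦Q j⟧. Cyclic Carlitz compositions are the nonempty Carlitz ones (C D) minus those whose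
-- first and last parts agree (Σ_i A i (1 + C A i)) plus the single parts (Σ_i x^i); this is the
-- right-hand side because x^i/(1+x^i)² = A i − A i² and x^{2i}/(1+x^i) = x^i − A i.

module Submission where

open import Defs
open import Level using (0ℓ)
open import Function.Base using (_∘_)
open import Function.Bundles using (_⇔_; mk⇔; Equivalence)
open import Relation.Binary.PropositionalEquality
open import Relation.Nullary.Decidable using (T?)
open import Data.Empty using (⊥; ⊥-elim)
open import Data.Product using (Σ; _×_; _,_; proj₂)
open import Data.Sum using (inj₁; inj₂)
open import Data.Bool using (Bool; true; false; if_then_else_; not; _∧_; T)
open import Data.Bool.Properties using (∧-identityʳ; ∧-zeroʳ; T-∧)
open import Data.Nat using (ℕ; zero; suc; _∸_; _≤_; _<_; z≤n; s≤s; _≡ᵇ_)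
open import Data.Nat as ℕ using ()
import Data.Nat.Properties as ℕ
open import Data.Nat.ListAction using (sum)
open import Data.Integer using (ℤ; +_; 0ℤ; 1ℤ; -_; _+_; _*_)
import Data.Integer.Properties as ℤ
open import Data.Integer.Tactic.RingSolver using (solve-∀)
open import Data.List using (List; []; _∷_; _++_; map; length; null; filterᵇ)
open import Data.List.Properties using (∷-injectiveʳ)
open import Data.List.Relation.Unary.All using (All; []; _∷_)
open import Data.List.Relation.Unary.AllPairs using ([]; _∷_)
open import Data.List.Relation.Unary.Any using (here)
open import Data.List.Relation.Unary.Linked using (Linked; [-]; _∷_)
open import Data.List.Relation.Unary.Unique.Propositional using (Unique)
import Data.List.Relation.Unary.Unique.Propositional.Properties as Unique
open import Data.List.Membership.Propositional using (_∈_)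
open import Data.List.Membership.Propositional.Properties
  using (∈-map⁺; ∈-map⁻; ∈-++⁺ˡ; ∈-++⁺ʳ; ∈-++⁻; ∈-filter⁺; ∈-filter⁻)
open import Algebra.Bundles using (CommutativeRing)
open import Algebra.Properties.CommutativeSemigroup ℤ.+-commutativeSemigroup using (interchange)

-- Finite sums

Σ0to-cong : ∀ n {f g : ℕ → ℤ} → (∀ k → k ≤ n → f k ≡ g k) → Σ0to n f ≡ Σ0to n g
Σ0to-cong zero    f≡g = f≡g 0 z≤n
Σ0to-cong (suc n) f≡g = cong₂ _+_ (Σ0to-cong n λ k k≤n → f≡g k (ℕ.m≤n⇒m≤1+n k≤n)) (f≡g (suc n) ℕ.≤-refl)

Σ0to-+ : ∀ n (f g : ℕ → ℤ) → Σ0to n (λ k → f k + g k) ≡ Σ0to n f + Σ0to n g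
Σ0to-+ zero    f g = refl
Σ0to-+ (suc n) f g = trans (cong (_+ (f (suc n) + g (suc n))) (Σ0to-+ n f g))
                           (interchange (Σ0to n f) (Σ0to n g) (f (suc n)) (g (suc n)))

*-distribˡ-Σ0to : ∀ n c (f : ℕ → ℤ) → c * Σ0to n f ≡ Σ0to n (λ k → c * f k)
*-distribˡ-Σ0to zero    c f = refl
*-distribˡ-Σ0to (suc n) c f = trans (ℤ.*-distribˡ-+ c (Σ0to n f) (f (suc n)))
                                    (cong (_+ c * f (suc n)) (*-distribˡ-Σ0to n c f))

Σ0to-zero : ∀ n {f : ℕ → ℤ} → (∀ k → k ≤ n → f k ≡ 0ℤ) → Σ0to n f ≡ 0ℤ
Σ0to-zero zero    f≡0 = f≡0 0 z≤n
Σ0to-zero (suc n) f≡0 = cong₂ _+_ (Σ0to-zero n λ k k≤n → f≡0 k (ℕ.m≤n⇒m≤1+n k≤n)) (f≡0 (suc n) ℕ.≤-refl)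

Σ0to-suc : ∀ n (f : ℕ → ℤ) → Σ0to (suc n) f ≡ f 0 + Σ0to n (λ k → f (suc k))
Σ0to-suc zero    f = refl
Σ0to-suc (suc n) f = trans (cong (_+ f (suc (suc n))) (Σ0to-suc n f))
                           (ℤ.+-assoc (f 0) (Σ0to n (λ k → f (suc k))) (f (suc (suc n))))

Σ0to-reverse : ∀ n (f : ℕ → ℤ) → Σ0to n f ≡ Σ0to n (λ k → f (n ∸ k))
Σ0to-reverse zero    f = refl
Σ0to-reverse (suc n) f = begin
  Σ0to n f + f (suc n)                         ≡⟨ cong (_+ f (suc n)) (Σ0to-reverse n f) ⟩
  Σ0to n (λ k → f (n ∸ k)) + f (suc n)         ≡⟨ ℤ.+-comm _ (f (suc n)) ⟩
  f (suc n) + Σ0to n (λ k → f (n ∸ k))         ≡⟨ Σ0to-suc n (λ k → f (suc n ∸ k)) ⟨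
  Σ0to (suc n) (λ k → f (suc n ∸ k))           ∎
  where open ≡-Reasoning

Σ0to-truncate : ∀ {m} n (f : ℕ → ℤ) → m ≤ n → (∀ k → m < k → k ≤ n → f k ≡ 0ℤ) → Σ0to n f ≡ Σ0to m f
Σ0to-truncate n f m≤n f≡0 with ℕ.m≤n⇒m<n∨m≡n m≤n
... | inj₂ refl = refl
Σ0to-truncate {m} (suc n) f _ f≡0 | inj₁ (s≤s m≤n) =
  trans (cong₂ _+_ (Σ0to-truncate n f m≤n λ k m<k k≤n → f≡0 k m<k (ℕ.m≤n⇒m≤1+n k≤n))
                   (f≡0 (suc n) (s≤s m≤n) ℕ.≤-refl))
        (ℤ.+-identityʳ (Σ0to m f))

Σ1to-cong : ∀ n {f g : ℕ → ℤ} → (∀ k → 1 ≤ k → k ≤ n → f k ≡ g k) → Σ1to n f ≡ Σ1to n g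
Σ1to-cong zero    f≡g = refl
Σ1to-cong (suc n) f≡g = cong₂ _+_ (Σ1to-cong n λ k 1≤k k≤n → f≡g k 1≤k (ℕ.m≤n⇒m≤1+n k≤n))
                                 (f≡g (suc n) (s≤s z≤n) ℕ.≤-refl)

Σ1to-zero : ∀ n → Σ1to n (λ _ → 0ℤ) ≡ 0ℤ
Σ1to-zero zero    = refl
Σ1to-zero (suc n) = trans (ℤ.+-identityʳ _) (Σ1to-zero n)

Σ1to-+ : ∀ n (f g : ℕ → ℤ) → Σ1to n (λ k → f k + g k) ≡ Σ1to n f + Σ1to n g
Σ1to-+ zero    f g = refl
Σ1to-+ (suc n) f g = trans (cong (_+ (f (suc n) + g (suc n))) (Σ1to-+ n f g))
                           (interchange (Σ1to n f) (Σ1to n g) (f (suc n)) (g (suc n)))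

Σ1to-neg : ∀ n (f : ℕ → ℤ) → Σ1to n (λ k → - f k) ≡ - Σ1to n f
Σ1to-neg zero    f = refl
Σ1to-neg (suc n) f = trans (cong (_+ - f (suc n)) (Σ1to-neg n f)) (sym (ℤ.neg-distrib-+ (Σ1to n f) (f (suc n))))

*-distribʳ-Σ1to : ∀ n c (f : ℕ → ℤ) → Σ1to n f * c ≡ Σ1to n (λ k → f k * c)
*-distribʳ-Σ1to zero    c f = refl
*-distribʳ-Σ1to (suc n) c f = trans (ℤ.*-distribʳ-+ c (Σ1to n f) (f (suc n)))
                                    (cong (_+ f (suc n) * c) (*-distribʳ-Σ1to n c f))

Σ1to-truncate : ∀ {m} n (f : ℕ → ℤ) → m ≤ n → (∀ k → m < k → k ≤ n → f k ≡ 0ℤ) → Σ1to n f ≡ Σ1to m f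
Σ1to-truncate n f m≤n f≡0 with ℕ.m≤n⇒m<n∨m≡n m≤n
... | inj₂ refl = refl
Σ1to-truncate {m} (suc n) f _ f≡0 | inj₁ (s≤s m≤n) =
  trans (cong₂ _+_ (Σ1to-truncate n f m≤n λ k m<k k≤n → f≡0 k m<k (ℕ.m≤n⇒m≤1+n k≤n))
                   (f≡0 (suc n) (s≤s m≤n) ℕ.≤-refl))
        (ℤ.+-identityʳ (Σ1to m f))

Σ0to-Σ1to-comm : ∀ n m (F : ℕ → ℕ → ℤ) → Σ0to n (λ k → Σ1to m (λ i → F i k)) ≡ Σ1to m (λ i → Σ0to n (F i))
Σ0to-Σ1to-comm n zero    F = Σ0to-zero n (λ _ _ → refl)
Σ0to-Σ1to-comm n (suc m) F = trans (Σ0to-+ n (λ k → Σ1to m (λ i → F i k)) (F (suc m)))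
                                   (cong (_+ Σ0to n (F (suc m))) (Σ0to-Σ1to-comm n m F))

Σ0to≡head+Σ1to : ∀ n (f : ℕ → ℤ) → Σ0to n f ≡ f 0 + Σ1to n f
Σ0to≡head+Σ1to zero    f = sym (ℤ.+-identityʳ (f 0))
Σ0to≡head+Σ1to (suc n) f = trans (cong (_+ f (suc n)) (Σ0to≡head+Σ1to n f))
                                 (ℤ.+-assoc (f 0) (Σ1to n f) (f (suc n)))

≡ᵇ-refl : ∀ i → (i ≡ᵇ i) ≡ true
≡ᵇ-refl zero    = refl
≡ᵇ-refl (suc i) = ≡ᵇ-refl i

≢⇔T-not-≡ᵇ : ∀ x y → x ≢ y ⇔ T (not (x ≡ᵇ y))
≢⇔T-not-≡ᵇ x y with x ≡ᵇ y in eq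
... | true  = mk⇔ (λ x≢y → x≢y (ℕ.≡ᵇ⇒≡ x y (subst T (sym eq) _))) λ ()
... | false = mk⇔ _ λ _ x≡y → subst T eq (ℕ.≡⇒≡ᵇ x y x≡y)

X^-diag : ∀ i → X^ i i ≡ 1ℤ
X^-diag i = cong (λ b → if b then 1ℤ else 0ℤ) (≡ᵇ-refl i)

X^-offDiag : ∀ {k i} → k ≢ i → X^ i k ≡ 0ℤ
X^-offDiag {zero}  {zero}  k≢i = ⊥-elim (k≢i refl)
X^-offDiag {zero}  {suc i} k≢i = refl
X^-offDiag {suc k} {zero}  k≢i = refl
X^-offDiag {suc k} {suc i} k≢i = X^-offDiag {k} {i} (k≢i ∘ cong suc)

Σ0to-δ-out : ∀ {n i} (g : ℕ → ℤ) → n < i → Σ0to n (λ k → X^ i k * g k) ≡ 0ℤ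
Σ0to-δ-out {n} g n<i = Σ0to-zero n λ k k≤n →
  cong (_* g k) (X^-offDiag (ℕ.<⇒≢ (ℕ.≤-<-trans k≤n n<i)))

Σ0to-δ : ∀ {n i} (g : ℕ → ℤ) → i ≤ n → Σ0to n (λ k → X^ i k * g k) ≡ g i
Σ0to-δ {n} g i≤n with ℕ.m≤n⇒m<n∨m≡n i≤n
Σ0to-δ {zero}  g _ | inj₂ refl = ℤ.*-identityˡ (g 0)
Σ0to-δ {suc n} g _ | inj₂ refl =
  trans (cong₂ _+_ (Σ0to-δ-out {n} g ℕ.≤-refl) (cong (_* g (suc n)) (X^-diag (suc n))))
        (trans (ℤ.+-identityˡ _) (ℤ.*-identityˡ (g (suc n))))
Σ0to-δ {suc n} {i} g _ | inj₁ (s≤s i≤n) =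
  trans (cong₂ _+_ (Σ0to-δ g i≤n) (cong (_* g (suc n)) (X^-offDiag (ℕ.<⇒≢ (s≤s i≤n) ∘ sym))))
        (ℤ.+-identityʳ (g i))

Σ1to-δ : ∀ {n i} (g : ℕ → ℤ) → 1 ≤ i → i ≤ n → Σ1to n (λ k → X^ i k * g k) ≡ g i
Σ1to-δ {n} {suc i} g _ i≤n = trans (sym (trans (Σ0to≡head+Σ1to n _) (ℤ.+-identityˡ _))) (Σ0to-δ g i≤n)

Σ1to-δ-out : ∀ {n i} (g : ℕ → ℤ) → n < i → Σ1to n (λ k → X^ i k * g k) ≡ 0ℤ
Σ1to-δ-out {n} {suc i} g n<i = trans (sym (trans (Σ0to≡head+Σ1to n _) (ℤ.+-identityˡ _))) (Σ0to-δ-out g n<i)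

-- The ring of formal power series

-- A record rather than a function type, so that f and g can be read off a proof of f ≈ g.
infix 4 _≈_
record _≈_ (f g : FPS) : Set where
  constructor coeffwise
  field coeff : ∀ n → f n ≡ g n
open _≈_ public

≈-refl : ∀ {f} → f ≈ f
≈-refl = coeffwise λ _ → refl

≈-sym : ∀ {f g} → f ≈ g → g ≈ f
≈-sym f≈g = coeffwise λ n → sym (coeff f≈g n)

≈-reflexive : ∀ {f g} → f ≡ g → f ≈ g
≈-reflexive refl = ≈-refl

≈-trans : ∀ {f g h} → f ≈ g → g ≈ h → f ≈ h
≈-trans f≈g g≈h = coeffwise λ n → trans (coeff f≈g n) (coeff g≈h n)

zeroS : FPS
zeroS _ = 0ℤ

tailS : FPS → FPS
tailS f k = f (suc k)

X^-⊗ : ∀ {i n} (f : FPS) → i ≤ n → (X^ i ⊗ f) n ≡ f (n ∸ i)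
X^-⊗ {n = n} f = Σ0to-δ (λ k → f (n ∸ k))

X^-⊗-low : ∀ {i n} (f : FPS) → n < i → (X^ i ⊗ f) n ≡ 0ℤ
X^-⊗-low {n = n} f = Σ0to-δ-out (λ k → f (n ∸ k))

⊗-suc : ∀ n (f g : FPS) → (f ⊗ g) (suc n) ≡ f 0 * g (suc n) + (tailS f ⊗ g) n
⊗-suc n f g = Σ0to-suc n (λ k → f k * g (suc n ∸ k))

⊗-congˡ-upTo : ∀ n {f f′} (g : FPS) → (∀ k → k ≤ n → f k ≡ f′ k) → (f ⊗ g) n ≡ (f′ ⊗ g) n
⊗-congˡ-upTo n g f≡f′ = Σ0to-cong n λ k k≤n → cong (_* g (n ∸ k)) (f≡f′ k k≤n)

⊗-scalarˡ : ∀ n c (f g : FPS) → ((λ k → c * f k) ⊗ g) n ≡ c * (f ⊗ g) n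
⊗-scalarˡ n c f g = trans (Σ0to-cong n λ k _ → ℤ.*-assoc c (f k) (g (n ∸ k)))
                          (sym (*-distribˡ-Σ0to n c (λ k → f k * g (n ∸ k))))

⊕-cong : ∀ {f f′ g g′} → f ≈ f′ → g ≈ g′ → f ⊕ g ≈ f′ ⊕ g′
⊕-cong f≈f′ g≈g′ = coeffwise λ n → cong₂ _+_ (coeff f≈f′ n) (coeff g≈g′ n)

⊖-cong : ∀ {f f′} → f ≈ f′ → ⊖ f ≈ ⊖ f′
⊖-cong f≈f′ = coeffwise λ n → cong -_ (coeff f≈f′ n)

⊗-cong : ∀ {f f′ g g′} → f ≈ f′ → g ≈ g′ → f ⊗ g ≈ f′ ⊗ g′
⊗-cong f≈f′ g≈g′ = coeffwise λ n → Σ0to-cong n λ k _ → cong₂ _*_ (coeff f≈f′ k) (coeff g≈g′ (n ∸ k))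

-- The fixed argument is explicit: FPS being a function type, Agda cannot recover h from h ⊕ f or h ⊗ f.
⊕-congˡ : ∀ h {f g} → f ≈ g → h ⊕ f ≈ h ⊕ g
⊕-congˡ h f≈g = ⊕-cong (≈-refl {h}) f≈g

⊕-congʳ : ∀ h {f g} → f ≈ g → f ⊕ h ≈ g ⊕ h
⊕-congʳ h f≈g = ⊕-cong f≈g (≈-refl {h})

⊗-congˡ : ∀ h {f g} → f ≈ g → h ⊗ f ≈ h ⊗ g
⊗-congˡ h f≈g = ⊗-cong (≈-refl {h}) f≈g

⊗-congʳ : ∀ h {f g} → f ≈ g → f ⊗ h ≈ g ⊗ h
⊗-congʳ h f≈g = ⊗-cong f≈g (≈-refl {h})

⊕-assoc : ∀ f g h → (f ⊕ g) ⊕ h ≈ f ⊕ (g ⊕ h)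
⊕-assoc f g h = coeffwise λ n → ℤ.+-assoc (f n) (g n) (h n)

⊕-comm : ∀ f g → f ⊕ g ≈ g ⊕ f
⊕-comm f g = coeffwise λ n → ℤ.+-comm (f n) (g n)

⊕-identityˡ : ∀ f → zeroS ⊕ f ≈ f
⊕-identityˡ f = coeffwise λ n → ℤ.+-identityˡ (f n)

⊕-identityʳ : ∀ f → f ⊕ zeroS ≈ f
⊕-identityʳ f = coeffwise λ n → ℤ.+-identityʳ (f n)

⊕-inverseˡ : ∀ f → ⊖ f ⊕ f ≈ zeroS
⊕-inverseˡ f = coeffwise λ n → ℤ.+-inverseˡ (f n)

⊕-inverseʳ : ∀ f → f ⊕ ⊖ f ≈ zeroS
⊕-inverseʳ f = coeffwise λ n → ℤ.+-inverseʳ (f n)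

⊗-identityˡ : ∀ f → oneS ⊗ f ≈ f
⊗-identityˡ f = coeffwise λ n → X^-⊗ f z≤n

⊗-comm : ∀ f g → f ⊗ g ≈ g ⊗ f
⊗-comm f g = coeffwise λ n → trans (Σ0to-reverse n (λ k → f k * g (n ∸ k)))
  (Σ0to-cong n λ k k≤n → trans (cong (λ m → f (n ∸ k) * g m) (ℕ.m∸[m∸n]≡n k≤n)) (ℤ.*-comm (f (n ∸ k)) (g k)))

⊗-identityʳ : ∀ f → f ⊗ oneS ≈ f
⊗-identityʳ f = ≈-trans (⊗-comm f oneS) (⊗-identityˡ f)

⊗-distribʳ : ∀ h f g → (f ⊕ g) ⊗ h ≈ f ⊗ h ⊕ g ⊗ h
⊗-distribʳ h f g = coeffwise λ n →
  trans (Σ0to-cong n λ k _ → ℤ.*-distribʳ-+ (h (n ∸ k)) (f k) (g k))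
        (Σ0to-+ n (λ k → f k * h (n ∸ k)) (λ k → g k * h (n ∸ k)))

⊗-distribˡ : ∀ h f g → h ⊗ (f ⊕ g) ≈ h ⊗ f ⊕ h ⊗ g
⊗-distribˡ h f g = ≈-trans (⊗-comm h (f ⊕ g))
  (≈-trans (⊗-distribʳ h f g) (⊕-cong (⊗-comm f h) (⊗-comm g h)))

-- Peeling off the constant term of f turns associativity into an induction on the coefficient index.
⊗-assoc-at : ∀ n (f g h : FPS) → ((f ⊗ g) ⊗ h) n ≡ (f ⊗ (g ⊗ h)) n
⊗-assoc-at zero    f g h = ℤ.*-assoc (f 0) (g 0) (h 0)
⊗-assoc-at (suc n) f g h = begin
  ((f ⊗ g) ⊗ h) (suc n)
    ≡⟨ ⊗-suc n (f ⊗ g) h ⟩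
  f 0 * g 0 * h (suc n) + (tailS (f ⊗ g) ⊗ h) n
    ≡⟨ cong (_+_ (f 0 * g 0 * h (suc n))) (⊗-congˡ-upTo n h λ k _ → ⊗-suc k f g) ⟩
  f 0 * g 0 * h (suc n) + (((λ k → f 0 * g (suc k)) ⊕ (tailS f ⊗ g)) ⊗ h) n
    ≡⟨ cong (_+_ (f 0 * g 0 * h (suc n))) (coeff (⊗-distribʳ h (λ k → f 0 * g (suc k)) (tailS f ⊗ g)) n) ⟩
  f 0 * g 0 * h (suc n) + (((λ k → f 0 * g (suc k)) ⊗ h) n + ((tailS f ⊗ g) ⊗ h) n)
    ≡⟨ cong (_+_ (f 0 * g 0 * h (suc n))) (cong₂ _+_ (⊗-scalarˡ n (f 0) (tailS g) h) (⊗-assoc-at n (tailS f) g h)) ⟩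
  f 0 * g 0 * h (suc n) + (f 0 * (tailS g ⊗ h) n + (tailS f ⊗ (g ⊗ h)) n)
    ≡⟨ rearrange (f 0) (g 0) (h (suc n)) ((tailS g ⊗ h) n) ((tailS f ⊗ (g ⊗ h)) n) ⟩
  f 0 * (g 0 * h (suc n) + (tailS g ⊗ h) n) + (tailS f ⊗ (g ⊗ h)) n
    ≡⟨ cong (λ x → f 0 * x + (tailS f ⊗ (g ⊗ h)) n) (⊗-suc n g h) ⟨
  f 0 * (g ⊗ h) (suc n) + (tailS f ⊗ (g ⊗ h)) n
    ≡⟨ ⊗-suc n f (g ⊗ h) ⟨
  (f ⊗ (g ⊗ h)) (suc n) ∎
  where
  open ≡-Reasoning
  rearrange : ∀ a b c x y → a * b * c + (a * x + y) ≡ a * (b * c + x) + y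
  rearrange = solve-∀

⊗-assoc : ∀ f g h → (f ⊗ g) ⊗ h ≈ f ⊗ (g ⊗ h)
⊗-assoc f g h = coeffwise λ n → ⊗-assoc-at n f g h

FPS-commutativeRing : CommutativeRing 0ℓ 0ℓ
FPS-commutativeRing = record
  { Carrier = FPS
  ; _≈_ = _≈_
  ; _+_ = _⊕_
  ; _*_ = _⊗_
  ; -_ = ⊖_
  ; 0# = zeroS
  ; 1# = oneS
  ; isCommutativeRing = record
    { isRing = record
      { +-isAbelianGroup = record
        { isGroup = record
          { isMonoid = record
            { isSemigroup = record
              { isMagma = record { isEquivalence = record { refl = ≈-refl ; sym = ≈-sym ; trans = ≈-trans } ; ∙-cong = ⊕-cong }
              ; assoc = ⊕-assoc }
            ; identity = ⊕-identityˡ , ⊕-identityʳ }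
          ; inverse = ⊕-inverseˡ , ⊕-inverseʳ
          ; ⁻¹-cong = ⊖-cong }
        ; comm = ⊕-comm }
      ; *-cong = ⊗-cong
      ; *-assoc = ⊗-assoc
      ; *-identity = ⊗-identityˡ , ⊗-identityʳ
      ; distrib = ⊗-distribˡ , ⊗-distribʳ }
    ; *-comm = ⊗-comm } }

open import Algebra.Properties.Ring (CommutativeRing.ring FPS-commutativeRing) using (-‿distribˡ-*; -‿distribʳ-*)
open import Relation.Binary.Reasoning.Setoid (CommutativeRing.setoid FPS-commutativeRing) as ≈-Reasoning using ()
open import Algebra.Properties.CommutativeSemigroup (CommutativeRing.*-commutativeSemigroup FPS-commutativeRing)
  using () renaming (interchange to ⊗-interchange)

OrderAtLeast : ℕ → FPS → Set
OrderAtLeast i f = ∀ m → m < i → f m ≡ 0ℤ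

OrderAtLeast-weaken : ∀ {i j} f → i ≤ j → OrderAtLeast j f → OrderAtLeast i f
OrderAtLeast-weaken f i≤j ord m m<i = ord m (ℕ.<-≤-trans m<i i≤j)

X^-+-shift : ∀ i j m → X^ (i ℕ.+ j) (i ℕ.+ m) ≡ X^ j m
X^-+-shift zero    j m = refl
X^-+-shift (suc i) j m = X^-+-shift i j m

X^-+ : ∀ i j → X^ (i ℕ.+ j) ≈ X^ i ⊗ X^ j
X^-+ i j = coeffwise λ n → case n
  where
  case : ∀ n → X^ (i ℕ.+ j) n ≡ (X^ i ⊗ X^ j) n
  case n with ℕ.<-≤-connex n i
  ... | inj₁ n<i = trans (X^-offDiag (ℕ.<⇒≢ (ℕ.<-≤-trans n<i (ℕ.m≤m+n i j)))) (sym (X^-⊗-low (X^ j) n<i))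
  ... | inj₂ i≤n = begin
    X^ (i ℕ.+ j) n              ≡⟨ cong (X^ (i ℕ.+ j)) (ℕ.m+[n∸m]≡n i≤n) ⟨
    X^ (i ℕ.+ j) (i ℕ.+ (n ∸ i)) ≡⟨ X^-+-shift i j (n ∸ i) ⟩
    X^ j (n ∸ i)                ≡⟨ X^-⊗ (X^ j) i≤n ⟨
    (X^ i ⊗ X^ j) n             ∎
    where open ≡-Reasoning

X^-order : ∀ i → OrderAtLeast i (X^ i)
X^-order i m m<i = X^-offDiag (ℕ.<⇒≢ m<i)

order-⊗ : ∀ {i j} f g → OrderAtLeast i f → OrderAtLeast j g → OrderAtLeast (i ℕ.+ j) (f ⊗ g)
order-⊗ {i} {j} f g ord-f ord-g m m<i+j = Σ0to-zero m term
  where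
  term : ∀ k → k ≤ m → f k * g (m ∸ k) ≡ 0ℤ
  term k k≤m with ℕ.<-≤-connex k i
  ... | inj₁ k<i = cong (_* g (m ∸ k)) (ord-f k k<i)
  ... | inj₂ i≤k = trans (cong (f k *_) (ord-g (m ∸ k) m∸k<j)) (ℤ.*-zeroʳ (f k))
    where
    m∸k<j : m ∸ k < j
    m∸k<j = ℕ.+-cancelˡ-< k (m ∸ k) j
              (subst (_< k ℕ.+ j) (sym (ℕ.m+[n∸m]≡n k≤m)) (ℕ.<-≤-trans m<i+j (ℕ.+-monoˡ-≤ j i≤k)))

^S-order : ∀ h → h 0 ≡ 0ℤ → ∀ k → OrderAtLeast k (h ^S k)
^S-order h h0≡0 zero    m ()
^S-order h h0≡0 (suc k) = order-⊗ h (h ^S k) (λ { zero _ → h0≡0 ; (suc _) (s≤s ()) }) (^S-order h h0≡0 k)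

-- Inverses

⊗-congʳ-upTo : ∀ n (f : FPS) {g g′} → (∀ k → k ≤ n → g k ≡ g′ k) → (f ⊗ g) n ≡ (f ⊗ g′) n
⊗-congʳ-upTo n f g≡g′ = Σ0to-cong n λ k _ → cong (f k *_) (g≡g′ (n ∸ k) (ℕ.m∸n≤m n k))

geometricPartial : FPS → ℕ → FPS
geometricPartial h N m = Σ0to N (λ k → (h ^S k) m)

geometric-telescope : ∀ h N → (oneS ⊕ ⊖ h) ⊗ geometricPartial h N ≈ oneS ⊕ ⊖ (h ^S suc N)
geometric-telescope h zero = begin
  (oneS ⊕ ⊖ h) ⊗ oneS   ≈⟨ ⊗-identityʳ (oneS ⊕ ⊖ h) ⟩
  oneS ⊕ ⊖ h            ≈⟨ ⊕-congˡ oneS (⊖-cong (⊗-identityʳ h)) ⟨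
  oneS ⊕ ⊖ (h ⊗ oneS)   ∎
  where open ≈-Reasoning
geometric-telescope h (suc N) = begin
  (oneS ⊕ ⊖ h) ⊗ (geometricPartial h N ⊕ p)
    ≈⟨ ⊗-distribˡ (oneS ⊕ ⊖ h) (geometricPartial h N) p ⟩
  (oneS ⊕ ⊖ h) ⊗ geometricPartial h N ⊕ (oneS ⊕ ⊖ h) ⊗ p
    ≈⟨ ⊕-cong (geometric-telescope h N) (⊗-distribʳ p oneS (⊖ h)) ⟩
  (oneS ⊕ ⊖ p) ⊕ (oneS ⊗ p ⊕ (⊖ h) ⊗ p)
    ≈⟨ ⊕-congˡ (oneS ⊕ ⊖ p) (⊕-cong (⊗-identityˡ p) (≈-sym (-‿distribˡ-* h p))) ⟩
  (oneS ⊕ ⊖ p) ⊕ (p ⊕ ⊖ (h ⊗ p))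
    ≈⟨ coeffwise (λ n → telescope (oneS n) (p n) ((h ⊗ p) n)) ⟩
  oneS ⊕ ⊖ (h ⊗ p) ∎
  where
  open ≈-Reasoning
  p = h ^S suc N
  telescope : ∀ a b c → (a + - b) + (b + - c) ≡ a + - c
  telescope = solve-∀

geometricPartial-upTo : ∀ h → h 0 ≡ 0ℤ → ∀ {m N} → m ≤ N → geometricPartial h N m ≡ inv1m h m
geometricPartial-upTo h h0≡0 {m} {N} m≤N =
  Σ0to-truncate N (λ k → (h ^S k) m) m≤N λ k m<k _ → ^S-order h h0≡0 k m m<k

inv1m-inverse : ∀ h → h 0 ≡ 0ℤ → (oneS ⊕ ⊖ h) ⊗ inv1m h ≈ oneS
inv1m-inverse h h0≡0 = coeffwise λ n → begin
  ((oneS ⊕ ⊖ h) ⊗ inv1m h) n                ≡⟨ ⊗-congʳ-upTo n (oneS ⊕ ⊖ h) (λ _ → geometricPartial-upTo h h0≡0) ⟨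
  ((oneS ⊕ ⊖ h) ⊗ geometricPartial h n) n   ≡⟨ coeff (geometric-telescope h n) n ⟩
  oneS n + - (h ^S suc n) n                 ≡⟨ cong (λ x → oneS n + - x) (^S-order h h0≡0 (suc n) n ℕ.≤-refl) ⟩
  oneS n + 0ℤ                               ≡⟨ ℤ.+-identityʳ (oneS n) ⟩
  oneS n                                    ∎
  where open ≡-Reasoning

invS-inverseʳ : ∀ f → f 0 ≡ 1ℤ → f ⊗ invS f ≈ oneS
invS-inverseʳ f f0≡1 = ≈-trans (⊗-congʳ (invS f) 1-[1-f]≈f) (inv1m-inverse (oneS ⊕ ⊖ f) [1-f]0≡0)
  where
  1-[1-f]≈f : f ≈ oneS ⊕ ⊖ (oneS ⊕ ⊖ f)
  1-[1-f]≈f = coeffwise λ n → sym (a-[a-b]≡b (oneS n) (f n))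
    where
    a-[a-b]≡b : ∀ a b → a + - (a + - b) ≡ b
    a-[a-b]≡b = solve-∀
  [1-f]0≡0 : (oneS ⊕ ⊖ f) 0 ≡ 0ℤ
  [1-f]0≡0 = cong (λ x → 1ℤ + - x) f0≡1

invS-unique : ∀ f g → f 0 ≡ 1ℤ → g ⊗ f ≈ oneS → g ≈ invS f
invS-unique f g f0≡1 gf≈1 = begin
  g                    ≈⟨ ⊗-identityʳ g ⟨
  g ⊗ oneS             ≈⟨ ⊗-congˡ g (invS-inverseʳ f f0≡1) ⟨
  g ⊗ (f ⊗ invS f)     ≈⟨ ⊗-assoc g f (invS f) ⟨
  (g ⊗ f) ⊗ invS f     ≈⟨ ⊗-congʳ (invS f) gf≈1 ⟩
  oneS ⊗ invS f        ≈⟨ ⊗-identityˡ (invS f) ⟩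
  invS f               ∎
  where open ≈-Reasoning

x≈u+d⊗x⇒x≈[1-d]⁻¹⊗u : ∀ d u x → d 0 ≡ 0ℤ → x ≈ u ⊕ d ⊗ x → x ≈ invS (oneS ⊕ ⊖ d) ⊗ u
x≈u+d⊗x⇒x≈[1-d]⁻¹⊗u d u x d0≡0 x≈u+dx = begin
  x                       ≈⟨ ⊗-identityˡ x ⟨
  oneS ⊗ x                ≈⟨ ⊗-congʳ x (≈-trans (⊗-comm c (oneS ⊕ ⊖ d)) (invS-inverseʳ (oneS ⊕ ⊖ d) [1-d]0≡1)) ⟨
  (c ⊗ (oneS ⊕ ⊖ d)) ⊗ x  ≈⟨ ⊗-assoc c (oneS ⊕ ⊖ d) x ⟩
  c ⊗ ((oneS ⊕ ⊖ d) ⊗ x)  ≈⟨ ⊗-congˡ c [1-d]x≈u ⟩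
  c ⊗ u                   ∎
  where
  open ≈-Reasoning
  c = invS (oneS ⊕ ⊖ d)
  [1-d]0≡1 : (oneS ⊕ ⊖ d) 0 ≡ 1ℤ
  [1-d]0≡1 = cong (λ z → 1ℤ + - z) d0≡0
  [1-d]x≈u : (oneS ⊕ ⊖ d) ⊗ x ≈ u
  [1-d]x≈u = begin
    (oneS ⊕ ⊖ d) ⊗ x         ≈⟨ ⊗-distribʳ x oneS (⊖ d) ⟩
    oneS ⊗ x ⊕ (⊖ d) ⊗ x     ≈⟨ ⊕-cong (⊗-identityˡ x) (≈-sym (-‿distribˡ-* d x)) ⟩
    x ⊕ ⊖ (d ⊗ x)            ≈⟨ coeffwise (λ n → trans (cong (_+ - (d ⊗ x) n) (coeff x≈u+dx n))
                                                      (a+b-b≡a (u n) ((d ⊗ x) n))) ⟩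
    u                        ∎
    where
    a+b-b≡a : ∀ a b → (a + b) + - b ≡ a
    a+b-b≡a = solve-∀

-- Sums Σ_{i≥1} F i of families with F i of order at least i

ΣS≥1-cong : ∀ {F G : ℕ → FPS} → (∀ i → 1 ≤ i → F i ≈ G i) → ΣS≥1 F ≈ ΣS≥1 G
ΣS≥1-cong F≈G = coeffwise λ n → Σ1to-cong n λ i 1≤i _ → coeff (F≈G i 1≤i) n

ΣS≥1-⊕ : ∀ (F G : ℕ → FPS) → ΣS≥1 (λ i → F i ⊕ G i) ≈ ΣS≥1 F ⊕ ΣS≥1 G
ΣS≥1-⊕ F G = coeffwise λ n → Σ1to-+ n (λ i → F i n) (λ i → G i n)

ΣS≥1-⊖ : ∀ (F : ℕ → FPS) → ΣS≥1 (λ i → ⊖ F i) ≈ ⊖ ΣS≥1 F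
ΣS≥1-⊖ F = coeffwise λ n → Σ1to-neg n (λ i → F i n)

ΣS≥1-⊗ : ∀ (F : ℕ → FPS) g → (∀ i → OrderAtLeast i (F i)) → ΣS≥1 F ⊗ g ≈ ΣS≥1 (λ i → F i ⊗ g)
ΣS≥1-⊗ F g ord = coeffwise λ n → begin
  Σ0to n (λ k → Σ1to k (λ i → F i k) * g (n ∸ k))
    ≡⟨ Σ0to-cong n (λ k k≤n → cong (_* g (n ∸ k)) (Σ1to-truncate n (λ i → F i k) k≤n λ i k<i _ → ord i k k<i)) ⟨
  Σ0to n (λ k → Σ1to n (λ i → F i k) * g (n ∸ k))
    ≡⟨ Σ0to-cong n (λ k _ → *-distribʳ-Σ1to n (g (n ∸ k)) (λ i → F i k)) ⟩
  Σ0to n (λ k → Σ1to n (λ i → F i k * g (n ∸ k)))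
    ≡⟨ Σ0to-Σ1to-comm n n (λ i k → F i k * g (n ∸ k)) ⟩
  Σ1to n (λ i → (F i ⊗ g) n) ∎
  where open ≡-Reasoning

-- The series x^i/(1+x^i) and 1/(1+x^i)

[1+X^]⁻¹ : ℕ → FPS
[1+X^]⁻¹ i = invS (oneS ⊕ X^ i)

X^/[1+X^] : ℕ → FPS
X^/[1+X^] i = X^ i ⊗ [1+X^]⁻¹ i

X^/[1+X^]-order : ∀ i → OrderAtLeast i (X^/[1+X^] i)
X^/[1+X^]-order i = OrderAtLeast-weaken (X^/[1+X^] i) (ℕ.m≤m+n i 0)
  (order-⊗ (X^ i) ([1+X^]⁻¹ i) (X^-order i) (λ _ ()))

module _ (i : ℕ) where
  private
    X = X^ (suc i)
    q = [1+X^]⁻¹ (suc i)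
    A = X^/[1+X^] (suc i)

  [1+X^]⁻¹-inverse : q ⊗ (oneS ⊕ X) ≈ oneS
  [1+X^]⁻¹-inverse = ≈-trans (⊗-comm q (oneS ⊕ X)) (invS-inverseʳ (oneS ⊕ X) refl)

  [1+X^]⁻¹+X^/[1+X^] : q ⊕ A ≈ oneS
  [1+X^]⁻¹+X^/[1+X^] = begin
    q ⊕ X ⊗ q            ≈⟨ ⊕-cong (⊗-identityʳ q) (⊗-comm q X) ⟨
    q ⊗ oneS ⊕ q ⊗ X     ≈⟨ ⊗-distribˡ q oneS X ⟨
    q ⊗ (oneS ⊕ X)       ≈⟨ [1+X^]⁻¹-inverse ⟩
    oneS                 ∎
    where open ≈-Reasoning

  [1+X^]⁻¹≈1-X^/[1+X^] : q ≈ oneS ⊕ ⊖ A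
  [1+X^]⁻¹≈1-X^/[1+X^] = coeffwise λ n → sym (trans (cong (_+ - A n) (sym (coeff [1+X^]⁻¹+X^/[1+X^] n)))
                                                     (a+b-b≡a (q n) (A n)))
    where
    a+b-b≡a : ∀ a b → (a + b) + - b ≡ a
    a+b-b≡a = solve-∀

  X^/[1+X^]≈1-[1+X^]⁻¹ : A ≈ oneS ⊕ ⊖ q
  X^/[1+X^]≈1-[1+X^]⁻¹ = coeffwise λ n → sym (trans (cong (_+ - q n) (sym (coeff [1+X^]⁻¹+X^/[1+X^] n)))
                                                     (a+b-a≡b (q n) (A n)))
    where
    a+b-a≡b : ∀ a b → (a + b) + - a ≡ b
    a+b-a≡b = solve-∀

  numerS-summand : X ⊗ invS ((oneS ⊕ X) ⊗ (oneS ⊕ X)) ≈ A ⊕ ⊖ (A ⊗ A)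
  numerS-summand = begin
    X ⊗ invS ((oneS ⊕ X) ⊗ (oneS ⊕ X))   ≈⟨ ⊗-congˡ X q²≈invS[1+X]² ⟨
    X ⊗ (q ⊗ q)                         ≈⟨ ⊗-assoc X q q ⟨
    A ⊗ q                               ≈⟨ ⊗-congˡ A [1+X^]⁻¹≈1-X^/[1+X^] ⟩
    A ⊗ (oneS ⊕ ⊖ A)                    ≈⟨ ⊗-distribˡ A oneS (⊖ A) ⟩
    A ⊗ oneS ⊕ A ⊗ ⊖ A                  ≈⟨ ⊕-cong (⊗-identityʳ A) (≈-sym (-‿distribʳ-* A A)) ⟩
    A ⊕ ⊖ (A ⊗ A)                       ∎
    where
    open ≈-Reasoning
    q²≈invS[1+X]² : q ⊗ q ≈ invS ((oneS ⊕ X) ⊗ (oneS ⊕ X))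
    q²≈invS[1+X]² = invS-unique ((oneS ⊕ X) ⊗ (oneS ⊕ X)) (q ⊗ q) refl (begin
      (q ⊗ q) ⊗ ((oneS ⊕ X) ⊗ (oneS ⊕ X))   ≈⟨ ⊗-interchange q q (oneS ⊕ X) (oneS ⊕ X) ⟩
      (q ⊗ (oneS ⊕ X)) ⊗ (q ⊗ (oneS ⊕ X))   ≈⟨ ⊗-cong [1+X^]⁻¹-inverse [1+X^]⁻¹-inverse ⟩
      oneS ⊗ oneS                           ≈⟨ ⊗-identityˡ oneS ⟩
      oneS                                  ∎)

  extraS-summand : X^ (suc i ℕ.+ suc i) ⊗ q ≈ X ⊕ ⊖ A
  extraS-summand = begin
    X^ (suc i ℕ.+ suc i) ⊗ q   ≈⟨ ⊗-congʳ q (X^-+ (suc i) (suc i)) ⟩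
    (X ⊗ X) ⊗ q                ≈⟨ ⊗-assoc X X q ⟩
    X ⊗ A                      ≈⟨ ⊗-congˡ X X^/[1+X^]≈1-[1+X^]⁻¹ ⟩
    X ⊗ (oneS ⊕ ⊖ q)           ≈⟨ ⊗-distribˡ X oneS (⊖ q) ⟩
    X ⊗ oneS ⊕ X ⊗ ⊖ q         ≈⟨ ⊕-cong (⊗-identityʳ X) (≈-sym (-‿distribʳ-* X q)) ⟩
    X ⊕ ⊖ A                    ∎
    where open ≈-Reasoning

  F≈X^⊗[R-F]⇒F≈X^/[1+X^]⊗R : ∀ F R → F ≈ X ⊗ (R ⊕ ⊖ F) → F ≈ A ⊗ R
  F≈X^⊗[R-F]⇒F≈X^/[1+X^]⊗R F R F≈X[R-F] = begin
    F                      ≈⟨ ⊗-identityˡ F ⟨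
    oneS ⊗ F               ≈⟨ ⊗-congʳ F [1+X^]⁻¹-inverse ⟨
    (q ⊗ (oneS ⊕ X)) ⊗ F   ≈⟨ ⊗-assoc q (oneS ⊕ X) F ⟩
    q ⊗ ((oneS ⊕ X) ⊗ F)   ≈⟨ ⊗-congˡ q [1+X]F≈XR ⟩
    q ⊗ (X ⊗ R)            ≈⟨ ⊗-assoc q X R ⟨
    (q ⊗ X) ⊗ R            ≈⟨ ⊗-congʳ R (⊗-comm q X) ⟩
    A ⊗ R                  ∎
    where
    open ≈-Reasoning
    F≈XR-XF : F ≈ X ⊗ R ⊕ ⊖ (X ⊗ F)
    F≈XR-XF = ≈-trans F≈X[R-F] (≈-trans (⊗-distribˡ X R (⊖ F)) (⊕-congˡ (X ⊗ R) (≈-sym (-‿distribʳ-* X F))))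
    [1+X]F≈XR : (oneS ⊕ X) ⊗ F ≈ X ⊗ R
    [1+X]F≈XR = ≈-trans (⊗-distribʳ F oneS X)
      (coeffwise λ n → trans (cong₂ _+_ (trans (coeff (⊗-identityˡ F) n) (coeff F≈XR-XF n)) refl)
                             (a-b+b≡a ((X ⊗ R) n) ((X ⊗ F) n)))
      where
      a-b+b≡a : ∀ a b → (a + - b) + b ≡ a
      a-b+b≡a = solve-∀

-- Compositions

mutual
  compositionsFuel : ℕ → ℕ → List (List ℕ)
  compositionsFuel f       zero    = [] ∷ []
  compositionsFuel zero    (suc n) = []
  compositionsFuel (suc f) (suc n) = firstPartUpTo f (suc n) (suc n)

  firstPartUpTo : ℕ → ℕ → ℕ → List (List ℕ)
  firstPartUpTo f m zero    = []
  firstPartUpTo f m (suc a) = firstPartUpTo f m a ++ map (suc a ∷_) (compositionsFuel f (m ∸ suc a))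

compositions : ℕ → List (List ℕ)
compositions n = compositionsFuel n n

mutual
  compositionsFuel-fuel : ∀ f g n → n ≤ f → n ≤ g → compositionsFuel f n ≡ compositionsFuel g n
  compositionsFuel-fuel f       g       zero    _         _         = refl
  compositionsFuel-fuel (suc f) (suc g) (suc n) (s≤s n≤f) (s≤s n≤g) = firstPartUpTo-fuel f g (suc n) (suc n) n≤f n≤g

  firstPartUpTo-fuel : ∀ f g m a → m ∸ 1 ≤ f → m ∸ 1 ≤ g → firstPartUpTo f m a ≡ firstPartUpTo g m a
  firstPartUpTo-fuel f g m zero    _ _ = refl
  firstPartUpTo-fuel f g m (suc a) m-1≤f m-1≤g = cong₂ _++_ (firstPartUpTo-fuel f g m a m-1≤f m-1≤g)
    (cong (map (suc a ∷_)) (compositionsFuel-fuel f g (m ∸ suc a)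
                                                  (ℕ.≤-trans m-a≤m-1 m-1≤f) (ℕ.≤-trans m-a≤m-1 m-1≤g)))
    where
    m-a≤m-1 : m ∸ suc a ≤ m ∸ 1
    m-a≤m-1 = ℕ.∸-monoʳ-≤ m (s≤s z≤n)

firstPartUpTo⁻ : ∀ f m a {W} → W ∈ firstPartUpTo f m a →
                 Σ ℕ λ b → Σ (List ℕ) λ R → 1 ≤ b × b ≤ a × W ≡ b ∷ R × R ∈ compositionsFuel f (m ∸ b)
firstPartUpTo⁻ f m (suc a) W∈ with ∈-++⁻ (firstPartUpTo f m a) W∈
... | inj₁ W∈′ = let (b , R , 1≤b , b≤a , W≡ , R∈) = firstPartUpTo⁻ f m a W∈′
                 in b , R , 1≤b , ℕ.m≤n⇒m≤1+n b≤a , W≡ , R∈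
... | inj₂ W∈′ = let (R , R∈ , W≡) = ∈-map⁻ (suc a ∷_) W∈′
                 in suc a , R , s≤s z≤n , ℕ.≤-refl , W≡ , R∈

firstPartUpTo⁺ : ∀ f m a {b R} → 1 ≤ b → b ≤ a → R ∈ compositionsFuel f (m ∸ b) → b ∷ R ∈ firstPartUpTo f m a
firstPartUpTo⁺ f m zero    (s≤s _) ()
firstPartUpTo⁺ f m (suc a) 1≤b b≤1+a R∈ with ℕ.m≤n⇒m<n∨m≡n b≤1+a
... | inj₂ refl        = ∈-++⁺ʳ (firstPartUpTo f m a) (∈-map⁺ (suc a ∷_) R∈)
... | inj₁ (s≤s b≤a)   = ∈-++⁺ˡ (firstPartUpTo⁺ f m a 1≤b b≤a R∈)

compositionsFuel⁻ : ∀ f n {W} → W ∈ compositionsFuel f n → All (0 <_) W × sum W ≡ n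
compositionsFuel⁻ f zero (here refl) = [] , refl
compositionsFuel⁻ (suc f) (suc n) W∈ with firstPartUpTo⁻ f (suc n) (suc n) W∈
... | b , R , 1≤b , b≤n , refl , R∈ =
  let (R>0 , ΣR≡) = compositionsFuel⁻ f (suc n ∸ b) R∈
  in 1≤b ∷ R>0 , trans (cong (b ℕ.+_) ΣR≡) (ℕ.m+[n∸m]≡n b≤n)

compositionsFuel⁺ : ∀ f W → All (0 <_) W → sum W ≤ f → W ∈ compositionsFuel f (sum W)
compositionsFuel⁺ f       []            []            _         = here refl
compositionsFuel⁺ (suc f) (suc b ∷ R) (s≤s z≤n ∷ R>0) (s≤s Σ≤f) =
  firstPartUpTo⁺ f (suc k) (suc k) (s≤s z≤n) (s≤s (ℕ.m≤m+n b (sum R)))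
    (subst (λ m → R ∈ compositionsFuel f m) (sym (ℕ.m+n∸m≡n b (sum R)))
           (compositionsFuel⁺ f R R>0 (ℕ.≤-trans (ℕ.m≤n+m (sum R) b) Σ≤f)))
  where k = b ℕ.+ sum R

∈-compositions⇔ : ∀ n W → W ∈ compositions n ⇔ (All (0 <_) W × sum W ≡ n)
∈-compositions⇔ n W = mk⇔ (compositionsFuel⁻ n n)
  λ { (W>0 , refl) → compositionsFuel⁺ (sum W) W W>0 ℕ.≤-refl }

mutual
  compositionsFuel-unique : ∀ f n → Unique (compositionsFuel f n)
  compositionsFuel-unique f       zero    = [] ∷ []
  compositionsFuel-unique zero    (suc n) = []
  compositionsFuel-unique (suc f) (suc n) = firstPartUpTo-unique f (suc n) (suc n)

  firstPartUpTo-unique : ∀ f m a → Unique (firstPartUpTo f m a)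
  firstPartUpTo-unique f m zero    = []
  firstPartUpTo-unique f m (suc a) =
    Unique.++⁺ (firstPartUpTo-unique f m a) (Unique.map⁺ ∷-injectiveʳ (compositionsFuel-unique f (m ∸ suc a))) disjoint
    where
    disjoint : ∀ {W} → W ∈ firstPartUpTo f m a × W ∈ map (suc a ∷_) (compositionsFuel f (m ∸ suc a)) → ⊥
    disjoint (W∈ , W∈′) with firstPartUpTo⁻ f m a W∈ | ∈-map⁻ (suc a ∷_) W∈′
    ... | _ , _ , _ , b≤a , refl , _ | _ , _ , refl = ℕ.<-irrefl refl (s≤s b≤a)

-- Generating functions of weighted compositions

sumWith : (List ℕ → ℤ) → List (List ℕ) → ℤ
sumWith w []       = 0ℤ
sumWith w (W ∷ Ws) = w W + sumWith w Ws

sumWith-zero : ∀ Ws → sumWith (λ _ → 0ℤ) Ws ≡ 0ℤ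
sumWith-zero []       = refl
sumWith-zero (W ∷ Ws) = trans (ℤ.+-identityˡ _) (sumWith-zero Ws)

sumWith-++ : ∀ w Ws Vs → sumWith w (Ws ++ Vs) ≡ sumWith w Ws + sumWith w Vs
sumWith-++ w []       Vs = sym (ℤ.+-identityˡ (sumWith w Vs))
sumWith-++ w (W ∷ Ws) Vs = trans (cong (_+_ (w W)) (sumWith-++ w Ws Vs)) (sym (ℤ.+-assoc (w W) (sumWith w Ws) (sumWith w Vs)))

sumWith-map : ∀ w g Ws → sumWith w (map g Ws) ≡ sumWith (w ∘ g) Ws
sumWith-map w g []       = refl
sumWith-map w g (W ∷ Ws) = cong (_+_ (w (g W))) (sumWith-map w g Ws)

sumWith-cong : ∀ {w v} Ws → (∀ W → w W ≡ v W) → sumWith w Ws ≡ sumWith v Ws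
sumWith-cong []       w≡v = refl
sumWith-cong (W ∷ Ws) w≡v = cong₂ _+_ (w≡v W) (sumWith-cong Ws w≡v)

sumWith-+ : ∀ w v Ws → sumWith (λ W → w W + v W) Ws ≡ sumWith w Ws + sumWith v Ws
sumWith-+ w v []       = refl
sumWith-+ w v (W ∷ Ws) = trans (cong (_+_ (w W + v W)) (sumWith-+ w v Ws)) (interchange (w W) (v W) (sumWith w Ws) (sumWith v Ws))

sumWith-neg : ∀ w Ws → sumWith (λ W → - w W) Ws ≡ - sumWith w Ws
sumWith-neg w []       = refl
sumWith-neg w (W ∷ Ws) = trans (cong (_+_ (- w W)) (sumWith-neg w Ws)) (sym (ℤ.neg-distrib-+ (w W) (sumWith w Ws)))

*-distribˡ-sumWith : ∀ c w Ws → c * sumWith w Ws ≡ sumWith (λ W → c * w W) Ws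
*-distribˡ-sumWith c w []       = ℤ.*-zeroʳ c
*-distribˡ-sumWith c w (W ∷ Ws) = trans (ℤ.*-distribˡ-+ c (w W) (sumWith w Ws)) (cong (_+_ (c * w W)) (*-distribˡ-sumWith c w Ws))

sumWith-firstPartUpTo : ∀ w f m a →
  sumWith w (firstPartUpTo f m a) ≡ Σ1to a (λ b → sumWith (λ R → w (b ∷ R)) (compositionsFuel f (m ∸ b)))
sumWith-firstPartUpTo w f m zero    = refl
sumWith-firstPartUpTo w f m (suc a) =
  trans (sumWith-++ w (firstPartUpTo f m a) (map (suc a ∷_) (compositionsFuel f (m ∸ suc a))))
        (cong₂ _+_ (sumWith-firstPartUpTo w f m a) (sumWith-map w (suc a ∷_) (compositionsFuel f (m ∸ suc a))))

compositionSeries : (List ℕ → ℤ) → FPS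
compositionSeries w n = sumWith w (compositions n)

compositionSeries-cong : ∀ {w v} → (∀ W → w W ≡ v W) → compositionSeries w ≈ compositionSeries v
compositionSeries-cong w≡v = coeffwise λ n → sumWith-cong (compositions n) w≡v

compositionSeries-+ : ∀ w v → compositionSeries (λ W → w W + v W) ≈ compositionSeries w ⊕ compositionSeries v
compositionSeries-+ w v = coeffwise λ n → sumWith-+ w v (compositions n)

compositionSeries-neg : ∀ w → compositionSeries (λ W → - w W) ≈ ⊖ compositionSeries w
compositionSeries-neg w = coeffwise λ n → sumWith-neg w (compositions n)

compositionSeries-byFirstPart-at : ∀ (w : List ℕ → ℤ) → w [] ≡ 0ℤ → ∀ n →
  compositionSeries w n ≡ Σ1to n (λ a → compositionSeries (λ R → w (a ∷ R)) (n ∸ a))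
compositionSeries-byFirstPart-at w w[]≡0 zero    = cong (_+ 0ℤ) w[]≡0
compositionSeries-byFirstPart-at w w[]≡0 (suc n) =
  trans (sumWith-firstPartUpTo w n (suc n) (suc n))
        (Σ1to-cong (suc n) λ { (suc a) _ _ → cong (sumWith (λ R → w (suc a ∷ R)))
                                 (compositionsFuel-fuel n (n ∸ a) (n ∸ a) (ℕ.m∸n≤m n a) ℕ.≤-refl) })

firstPart : List ℕ → ℕ
firstPart []      = 0
firstPart (a ∷ _) = a

-- firstPart [] = 0 is never a part, so for j ≥ 1 the factor X^ j (firstPart W) indicates that W starts with j.
compositionSeries-startingWith : ∀ j → 1 ≤ j → ∀ (w : List ℕ → ℤ) →
  compositionSeries (λ W → X^ j (firstPart W) * w W) ≈ X^ j ⊗ compositionSeries (λ R → w (j ∷ R))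
compositionSeries-startingWith j@(suc _) _ w = coeffwise λ n → begin
  compositionSeries (λ W → X^ j (firstPart W) * w W) n
    ≡⟨ compositionSeries-byFirstPart-at (λ W → X^ j (firstPart W) * w W) refl n ⟩
  Σ1to n (λ a → compositionSeries (λ R → X^ j a * w (a ∷ R)) (n ∸ a))
    ≡⟨ Σ1to-cong n (λ a _ _ → *-distribˡ-sumWith (X^ j a) (λ R → w (a ∷ R)) (compositions (n ∸ a))) ⟨
  Σ1to n (λ a → X^ j a * G a (n ∸ a))
    ≡⟨ evaluate n ⟩
  (X^ j ⊗ G j) n ∎
  where
  open ≡-Reasoning
  G : ℕ → FPS
  G a = compositionSeries (λ R → w (a ∷ R))
  evaluate : ∀ n → Σ1to n (λ a → X^ j a * G a (n ∸ a)) ≡ (X^ j ⊗ G j) n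
  evaluate n with ℕ.<-≤-connex n j
  ... | inj₁ n<j = trans (Σ1to-δ-out (λ a → G a (n ∸ a)) n<j) (sym (X^-⊗-low (G j) n<j))
  ... | inj₂ j≤n = trans (Σ1to-δ (λ a → G a (n ∸ a)) (s≤s z≤n) j≤n) (sym (X^-⊗ (G j) j≤n))

compositionSeries-byFirstPart : ∀ (w : List ℕ → ℤ) → w [] ≡ 0ℤ →
  compositionSeries w ≈ ΣS≥1 (λ j → compositionSeries (λ W → X^ j (firstPart W) * w W))
compositionSeries-byFirstPart w w[]≡0 = coeffwise λ n →
  trans (compositionSeries-byFirstPart-at w w[]≡0 n)
        (Σ1to-cong n λ j 1≤j j≤n → sym (trans (coeff (compositionSeries-startingWith j 1≤j w) n)
                                              (X^-⊗ (compositionSeries (λ R → w (j ∷ R))) j≤n)))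

-- Carlitz compositions with a condition on the last part

⟦_⟧ : Bool → ℤ
⟦ b ⟧ = if b then 1ℤ else 0ℤ

⟦_⟧S : Bool → FPS
⟦ b ⟧S = if b then oneS else zeroS

-- The adjacency test is written b ≡ᵇ a so that it is literally the test in X^ a b.
carlitzEndingIn : (ℕ → Bool) → List ℕ → Bool
carlitzEndingIn Q []          = false
carlitzEndingIn Q (a ∷ [])    = Q a
carlitzEndingIn Q (a ∷ b ∷ r) = not (b ≡ᵇ a) ∧ carlitzEndingIn Q (b ∷ r)

T-carlitzEndingIn : ∀ Q a r → T (carlitzEndingIn Q (a ∷ r)) ⇔ (Linked _≢_ (a ∷ r) × T (Q (lastOf a r)))
T-carlitzEndingIn Q a []      = mk⇔ ([-] ,_) proj₂
T-carlitzEndingIn Q a (b ∷ r) = mk⇔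
  (λ t → let (b≢a , t′) = Equivalence.to T-∧ t
             (linked , q) = Equivalence.to (T-carlitzEndingIn Q b r) t′
         in ≢-sym (Equivalence.from (≢⇔T-not-≡ᵇ b a) b≢a) ∷ linked , q)
  (λ { (a≢b ∷ linked , q) → Equivalence.from T-∧
         (Equivalence.to (≢⇔T-not-≡ᵇ b a) (≢-sym a≢b) , Equivalence.from (T-carlitzEndingIn Q b r) (linked , q)) })

-- Prepending j to R gives a Carlitz composition iff R is empty (and Q j) or R is one not starting with j.
⟦carlitzEndingIn⟧-∷ : ∀ Q j R → ⟦ carlitzEndingIn Q (j ∷ R) ⟧ ≡
  (⟦ null R ∧ Q j ⟧ + ⟦ carlitzEndingIn Q R ⟧) + - (X^ j (firstPart R) * ⟦ carlitzEndingIn Q R ⟧)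
⟦carlitzEndingIn⟧-∷ Q j []      = sym (x+0-y0≡x ⟦ Q j ⟧ (X^ j 0))
  where
  x+0-y0≡x : ∀ x y → (x + 0ℤ) + - (y * 0ℤ) ≡ x
  x+0-y0≡x = solve-∀
⟦carlitzEndingIn⟧-∷ Q j (b ∷ r) = indicator (b ≡ᵇ j) (carlitzEndingIn Q (b ∷ r))
  where
  indicator : ∀ x c → ⟦ not x ∧ c ⟧ ≡ (0ℤ + ⟦ c ⟧) + - (⟦ x ⟧ * ⟦ c ⟧)
  indicator true  true  = refl
  indicator true  false = refl
  indicator false true  = refl
  indicator false false = refl

compositionSeries-null : compositionSeries (λ R → ⟦ null R ⟧) ≈ oneS
compositionSeries-null = coeffwise λ where
  zero    → refl
  (suc n) → trans (sumWith-firstPartUpTo (λ R → ⟦ null R ⟧) n (suc n) (suc n))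
                  (trans (Σ1to-cong (suc n) (λ a _ _ → sumWith-zero (compositionsFuel n (suc n ∸ a)))) (Σ1to-zero (suc n)))

compositionSeries-null∧ : ∀ b → compositionSeries (λ R → ⟦ null R ∧ b ⟧) ≈ ⟦ b ⟧S
compositionSeries-null∧ true  = ≈-trans (compositionSeries-cong λ R → cong ⟦_⟧ (∧-identityʳ (null R))) compositionSeries-null
compositionSeries-null∧ false = ≈-trans (compositionSeries-cong λ R → cong ⟦_⟧ (∧-zeroʳ (null R)))
                                        (coeffwise λ n → sumWith-zero (compositions n))

carlitzSeries : (ℕ → Bool) → FPS
carlitzSeries Q = compositionSeries (λ W → ⟦ carlitzEndingIn Q W ⟧)

carlitzSeriesStartingWith : (ℕ → Bool) → ℕ → FPS
carlitzSeriesStartingWith Q j = compositionSeries (λ W → X^ j (firstPart W) * ⟦ carlitzEndingIn Q W ⟧)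

carlitzSeriesStartingWith-rec : ∀ Q j → 1 ≤ j →
  carlitzSeriesStartingWith Q j ≈ X^ j ⊗ ((⟦ Q j ⟧S ⊕ carlitzSeries Q) ⊕ ⊖ carlitzSeriesStartingWith Q j)
carlitzSeriesStartingWith-rec Q j 1≤j = ≈-trans (compositionSeries-startingWith j 1≤j w) (⊗-congˡ (X^ j) (begin
  compositionSeries (λ R → w (j ∷ R))
    ≈⟨ compositionSeries-cong (⟦carlitzEndingIn⟧-∷ Q j) ⟩
  compositionSeries (λ R → (⟦ null R ∧ Q j ⟧ + w R) + - (X^ j (firstPart R) * w R))
    ≈⟨ compositionSeries-+ (λ R → ⟦ null R ∧ Q j ⟧ + w R) (λ R → - (X^ j (firstPart R) * w R)) ⟩
  compositionSeries (λ R → ⟦ null R ∧ Q j ⟧ + w R) ⊕ compositionSeries (λ R → - (X^ j (firstPart R) * w R))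
    ≈⟨ ⊕-cong (compositionSeries-+ (λ R → ⟦ null R ∧ Q j ⟧) w) (compositionSeries-neg (λ R → X^ j (firstPart R) * w R)) ⟩
  (compositionSeries (λ R → ⟦ null R ∧ Q j ⟧) ⊕ carlitzSeries Q) ⊕ ⊖ carlitzSeriesStartingWith Q j
    ≈⟨ ⊕-congʳ (⊖ carlitzSeriesStartingWith Q j) (⊕-congʳ (carlitzSeries Q) (compositionSeries-null∧ (Q j))) ⟩
  (⟦ Q j ⟧S ⊕ carlitzSeries Q) ⊕ ⊖ carlitzSeriesStartingWith Q j ∎))
  where
  open ≈-Reasoning
  w : List ℕ → ℤ
  w W = ⟦ carlitzEndingIn Q W ⟧

carlitzSeriesStartingWith-solution : ∀ Q i →
  carlitzSeriesStartingWith Q (suc i) ≈ X^/[1+X^] (suc i) ⊗ (⟦ Q (suc i) ⟧S ⊕ carlitzSeries Q)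
carlitzSeriesStartingWith-solution Q i = F≈X^⊗[R-F]⇒F≈X^/[1+X^]⊗R i
  (carlitzSeriesStartingWith Q (suc i)) (⟦ Q (suc i) ⟧S ⊕ carlitzSeries Q) (carlitzSeriesStartingWith-rec Q (suc i) (s≤s z≤n))

carlitzGF : FPS
carlitzGF = invS (oneS ⊕ ⊖ denomSumS)

carlitzSeries-solution : ∀ Q → carlitzSeries Q ≈ carlitzGF ⊗ ΣS≥1 (λ j → X^/[1+X^] j ⊗ ⟦ Q j ⟧S)
carlitzSeries-solution Q = x≈u+d⊗x⇒x≈[1-d]⁻¹⊗u denomSumS U G refl (begin
  G                                     ≈⟨ compositionSeries-byFirstPart (λ W → ⟦ carlitzEndingIn Q W ⟧) refl ⟩
  ΣS≥1 (carlitzSeriesStartingWith Q)    ≈⟨ ΣS≥1-cong (λ { (suc i) _ → carlitzSeriesStartingWith-solution Q i }) ⟩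
  ΣS≥1 (λ j → A j ⊗ (⟦ Q j ⟧S ⊕ G))     ≈⟨ ΣS≥1-cong (λ j _ → ⊗-distribˡ (A j) ⟦ Q j ⟧S G) ⟩
  ΣS≥1 (λ j → A j ⊗ ⟦ Q j ⟧S ⊕ A j ⊗ G) ≈⟨ ΣS≥1-⊕ (λ j → A j ⊗ ⟦ Q j ⟧S) (λ j → A j ⊗ G) ⟩
  U ⊕ ΣS≥1 (λ j → A j ⊗ G)              ≈⟨ ⊕-congˡ U (ΣS≥1-⊗ A G X^/[1+X^]-order) ⟨
  U ⊕ denomSumS ⊗ G                     ∎)
  where
  open ≈-Reasoning
  A = X^/[1+X^]
  G = carlitzSeries Q
  U = ΣS≥1 (λ j → A j ⊗ ⟦ Q j ⟧S)

⊗-⟦⟧S : ∀ f b n → (f ⊗ ⟦ b ⟧S) n ≡ ⟦ b ⟧ * f n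
⊗-⟦⟧S f true  n = trans (coeff (⊗-identityʳ f) n) (sym (ℤ.*-identityˡ (f n)))
⊗-⟦⟧S f false n = Σ0to-zero n λ k _ → ℤ.*-zeroʳ (f k)

carlitzSeries-nonempty : carlitzSeries (λ _ → true) ≈ carlitzGF ⊗ denomSumS
carlitzSeries-nonempty = ≈-trans (carlitzSeries-solution (λ _ → true))
  (⊗-congˡ carlitzGF (ΣS≥1-cong λ j _ → ⊗-identityʳ (X^/[1+X^] j)))

carlitzSeries-endingIn : ∀ i → 1 ≤ i → carlitzSeries (_≡ᵇ i) ≈ carlitzGF ⊗ X^/[1+X^] i
carlitzSeries-endingIn i 1≤i = ≈-trans (carlitzSeries-solution (_≡ᵇ i)) (⊗-congˡ carlitzGF (coeffwise select))
  where
  select : ∀ n → Σ1to n (λ j → (X^/[1+X^] j ⊗ ⟦ j ≡ᵇ i ⟧S) n) ≡ X^/[1+X^] i n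
  select n with ℕ.<-≤-connex n i
  ... | inj₁ n<i = trans (Σ1to-cong n (λ j _ _ → ⊗-⟦⟧S (X^/[1+X^] j) (j ≡ᵇ i) n))
                         (trans (Σ1to-δ-out (λ j → X^/[1+X^] j n) n<i) (sym (X^/[1+X^]-order i n n<i)))
  ... | inj₂ i≤n = trans (Σ1to-cong n (λ j _ _ → ⊗-⟦⟧S (X^/[1+X^] j) (j ≡ᵇ i) n))
                         (Σ1to-δ (λ j → X^/[1+X^] j n) 1≤i i≤n)

firstEqualsLastSeries : FPS
firstEqualsLastSeries = compositionSeries (λ W → ⟦ carlitzEndingIn (_≡ᵇ firstPart W) W ⟧)

firstEqualsLastSeries-solution :
  firstEqualsLastSeries ≈ ΣS≥1 (λ i → X^/[1+X^] i ⊗ (oneS ⊕ carlitzGF ⊗ X^/[1+X^] i))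
firstEqualsLastSeries-solution = begin
  firstEqualsLastSeries
    ≈⟨ compositionSeries-byFirstPart (λ W → ⟦ carlitzEndingIn (_≡ᵇ firstPart W) W ⟧) refl ⟩
  ΣS≥1 (λ i → compositionSeries (λ W → X^ i (firstPart W) * ⟦ carlitzEndingIn (_≡ᵇ firstPart W) W ⟧))
    ≈⟨ ΣS≥1-cong (λ i _ → compositionSeries-cong (startsWith i)) ⟩
  ΣS≥1 (λ i → carlitzSeriesStartingWith (_≡ᵇ i) i)
    ≈⟨ ΣS≥1-cong (λ { i@(suc i′) 1≤i → ≈-trans (carlitzSeriesStartingWith-solution (_≡ᵇ i) i′)
         (⊗-congˡ (X^/[1+X^] i) (⊕-cong (≈-reflexive (cong ⟦_⟧S (≡ᵇ-refl i))) (carlitzSeries-endingIn i 1≤i))) }) ⟩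
  ΣS≥1 (λ i → X^/[1+X^] i ⊗ (oneS ⊕ carlitzGF ⊗ X^/[1+X^] i)) ∎
  where
  open ≈-Reasoning
  startsWith : ∀ i W → X^ i (firstPart W) * ⟦ carlitzEndingIn (_≡ᵇ firstPart W) W ⟧
                     ≡ X^ i (firstPart W) * ⟦ carlitzEndingIn (_≡ᵇ i) W ⟧
  startsWith i W with firstPart W ≡ᵇ i in eq
  ... | true  = cong (λ k → 1ℤ * ⟦ carlitzEndingIn (_≡ᵇ k) W ⟧) (ℕ.≡ᵇ⇒≡ (firstPart W) i (subst T (sym eq) _))
  ... | false = refl

isSingleton : List ℕ → Bool
isSingleton []      = false
isSingleton (_ ∷ R) = null R

singletonSeries : FPS
singletonSeries = compositionSeries (λ W → ⟦ isSingleton W ⟧)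

singletonSeries-closedForm : singletonSeries ≈ ΣS≥1 X^
singletonSeries-closedForm = ≈-trans (compositionSeries-byFirstPart (λ W → ⟦ isSingleton W ⟧) refl)
  (ΣS≥1-cong λ i 1≤i → ≈-trans (compositionSeries-startingWith i 1≤i (λ W → ⟦ isSingleton W ⟧))
                               (≈-trans (⊗-congˡ (X^ i) compositionSeries-null) (⊗-identityʳ (X^ i))))

-- Cyclic Carlitz compositions

isCyclicCarlitz : List ℕ → Bool
isCyclicCarlitz []          = false
isCyclicCarlitz (a ∷ [])    = true
isCyclicCarlitz (a ∷ b ∷ r) = carlitzEndingIn (λ z → not (z ≡ᵇ a)) (a ∷ b ∷ r)

⟦carlitzEndingIn⟧-not : ∀ Q W →
  ⟦ carlitzEndingIn (not ∘ Q) W ⟧ ≡ ⟦ carlitzEndingIn (λ _ → true) W ⟧ + - ⟦ carlitzEndingIn Q W ⟧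
⟦carlitzEndingIn⟧-not Q []          = refl
⟦carlitzEndingIn⟧-not Q (a ∷ [])    with Q a
... | true  = refl
... | false = refl
⟦carlitzEndingIn⟧-not Q (a ∷ R@(b ∷ _)) = guard (not (b ≡ᵇ a)) (⟦carlitzEndingIn⟧-not Q R)
  where
  guard : ∀ x {c c′ t} → ⟦ c′ ⟧ ≡ ⟦ t ⟧ + - ⟦ c ⟧ → ⟦ x ∧ c′ ⟧ ≡ ⟦ x ∧ t ⟧ + - ⟦ x ∧ c ⟧
  guard true  eq = eq
  guard false _  = refl

-- Inclusion–exclusion: a Carlitz composition is cyclic unless its first and last parts agree,
-- which is harmless for a single part.
⟦isCyclicCarlitz⟧ : ∀ W → ⟦ isCyclicCarlitz W ⟧ ≡
  (⟦ carlitzEndingIn (λ _ → true) W ⟧ + - ⟦ carlitzEndingIn (_≡ᵇ firstPart W) W ⟧) + ⟦ isSingleton W ⟧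
⟦isCyclicCarlitz⟧ []          = refl
⟦isCyclicCarlitz⟧ (a ∷ [])    rewrite ≡ᵇ-refl a = refl
⟦isCyclicCarlitz⟧ (a ∷ b ∷ r) = trans (⟦carlitzEndingIn⟧-not (_≡ᵇ a) (a ∷ b ∷ r)) (sym (ℤ.+-identityʳ _))

cyclicCarlitzSeries : FPS
cyclicCarlitzSeries = compositionSeries (λ W → ⟦ isCyclicCarlitz W ⟧)

cyclicCarlitzSeries-decomposition :
  cyclicCarlitzSeries ≈ (carlitzSeries (λ _ → true) ⊕ ⊖ firstEqualsLastSeries) ⊕ singletonSeries
cyclicCarlitzSeries-decomposition = begin
  cyclicCarlitzSeries
    ≈⟨ compositionSeries-cong ⟦isCyclicCarlitz⟧ ⟩
  compositionSeries (λ W → (all W + - firstEqualsLast W) + single W)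
    ≈⟨ compositionSeries-+ (λ W → all W + - firstEqualsLast W) single ⟩
  compositionSeries (λ W → all W + - firstEqualsLast W) ⊕ singletonSeries
    ≈⟨ ⊕-congʳ singletonSeries (compositionSeries-+ all (λ W → - firstEqualsLast W)) ⟩
  (carlitzSeries (λ _ → true) ⊕ compositionSeries (λ W → - firstEqualsLast W)) ⊕ singletonSeries
    ≈⟨ ⊕-congʳ singletonSeries (⊕-congˡ (carlitzSeries (λ _ → true)) (compositionSeries-neg firstEqualsLast)) ⟩
  (carlitzSeries (λ _ → true) ⊕ ⊖ firstEqualsLastSeries) ⊕ singletonSeries ∎
  where
  open ≈-Reasoning
  all firstEqualsLast single : List ℕ → ℤ
  all W = ⟦ carlitzEndingIn (λ _ → true) W ⟧
  firstEqualsLast W = ⟦ carlitzEndingIn (_≡ᵇ firstPart W) W ⟧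
  single W = ⟦ isSingleton W ⟧

length-filterᵇ : ∀ b Ws → + length (filterᵇ b Ws) ≡ sumWith (⟦_⟧ ∘ b) Ws
length-filterᵇ b []       = refl
length-filterᵇ b (W ∷ Ws) with b W
... | true  = cong (_+_ 1ℤ) (length-filterᵇ b Ws)
... | false = trans (length-filterᵇ b Ws) (sym (ℤ.+-identityˡ _))

T-isCyclicCarlitz : ∀ W → T (isCyclicCarlitz W) ⇔ (NonEmpty W × Linked _≢_ W × CyclicEnd W)
T-isCyclicCarlitz []          = mk⇔ (λ ()) λ ()
T-isCyclicCarlitz (a ∷ [])    = mk⇔ (λ _ → _ , [-] , _) _
T-isCyclicCarlitz (a ∷ b ∷ r) = mk⇔
  (λ t → let (linked , q) = Equivalence.to (T-carlitzEndingIn _ a (b ∷ r)) t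
         in _ , linked , Equivalence.from (≢⇔T-not-≡ᵇ (lastOf b r) a) q)
  (λ (_ , linked , end) → Equivalence.from (T-carlitzEndingIn _ a (b ∷ r))
                              (linked , Equivalence.to (≢⇔T-not-≡ᵇ (lastOf b r) a) end))

∈-cyclicCarlitz⇔ : ∀ n W → W ∈ filterᵇ isCyclicCarlitz (compositions n) ⇔ (CyclicCarlitz W × sum W ≡ n)
∈-cyclicCarlitz⇔ n W = mk⇔
  (λ W∈ → let (W∈′ , t) = ∈-filter⁻ (T? ∘ isCyclicCarlitz) W∈
              (positive , sum≡n) = Equivalence.to (∈-compositions⇔ n W) W∈′
              (nonEmpty , linked , end) = Equivalence.to (T-isCyclicCarlitz W) t
          in (nonEmpty , positive , linked , end) , sum≡n)
  (λ ((nonEmpty , positive , linked , end) , sum≡n) →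
     ∈-filter⁺ (T? ∘ isCyclicCarlitz) (Equivalence.from (∈-compositions⇔ n W) (positive , sum≡n))
               (Equivalence.from (T-isCyclicCarlitz W) (nonEmpty , linked , end)))

squaresSum : FPS
squaresSum = ΣS≥1 (λ i → X^/[1+X^] i ⊗ X^/[1+X^] i)

X^/[1+X^]-square-order : ∀ i → OrderAtLeast i (X^/[1+X^] i ⊗ X^/[1+X^] i)
X^/[1+X^]-square-order i = OrderAtLeast-weaken (X^/[1+X^] i ⊗ X^/[1+X^] i) (ℕ.m≤m+n i i)
  (order-⊗ (X^/[1+X^] i) (X^/[1+X^] i) (X^/[1+X^]-order i) (X^/[1+X^]-order i))

numerS-closedForm : numerS ≈ denomSumS ⊕ ⊖ squaresSum
numerS-closedForm = ≈-trans (ΣS≥1-cong λ { (suc i) _ → numerS-summand i })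
  (≈-trans (ΣS≥1-⊕ X^/[1+X^] (λ i → ⊖ (X^/[1+X^] i ⊗ X^/[1+X^] i)))
           (⊕-congˡ denomSumS (ΣS≥1-⊖ (λ i → X^/[1+X^] i ⊗ X^/[1+X^] i))))

extraS-closedForm : extraS ≈ ΣS≥1 X^ ⊕ ⊖ denomSumS
extraS-closedForm = ≈-trans (ΣS≥1-cong λ { (suc i) _ → extraS-summand i })
  (≈-trans (ΣS≥1-⊕ X^ (λ i → ⊖ X^/[1+X^] i)) (⊕-congˡ (ΣS≥1 X^) (ΣS≥1-⊖ X^/[1+X^])))

firstEqualsLastSeries-closedForm : firstEqualsLastSeries ≈ denomSumS ⊕ squaresSum ⊗ carlitzGF
firstEqualsLastSeries-closedForm = begin
  firstEqualsLastSeries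
    ≈⟨ firstEqualsLastSeries-solution ⟩
  ΣS≥1 (λ i → A i ⊗ (oneS ⊕ carlitzGF ⊗ A i))
    ≈⟨ ΣS≥1-cong (λ i _ → expand (A i)) ⟩
  ΣS≥1 (λ i → A i ⊕ (A i ⊗ A i) ⊗ carlitzGF)
    ≈⟨ ΣS≥1-⊕ A (λ i → (A i ⊗ A i) ⊗ carlitzGF) ⟩
  denomSumS ⊕ ΣS≥1 (λ i → (A i ⊗ A i) ⊗ carlitzGF)
    ≈⟨ ⊕-congˡ denomSumS (ΣS≥1-⊗ (λ i → A i ⊗ A i) carlitzGF X^/[1+X^]-square-order) ⟨
  denomSumS ⊕ squaresSum ⊗ carlitzGF ∎
  where
  open ≈-Reasoning
  A = X^/[1+X^]
  expand : ∀ a → a ⊗ (oneS ⊕ carlitzGF ⊗ a) ≈ a ⊕ (a ⊗ a) ⊗ carlitzGF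
  expand a = begin
    a ⊗ (oneS ⊕ carlitzGF ⊗ a)         ≈⟨ ⊗-distribˡ a oneS (carlitzGF ⊗ a) ⟩
    a ⊗ oneS ⊕ a ⊗ (carlitzGF ⊗ a)     ≈⟨ ⊕-cong (⊗-identityʳ a) (⊗-congˡ a (⊗-comm carlitzGF a)) ⟩
    a ⊕ a ⊗ (a ⊗ carlitzGF)            ≈⟨ ⊕-congˡ a (⊗-assoc a a carlitzGF) ⟨
    a ⊕ (a ⊗ a) ⊗ carlitzGF            ∎

rhsS≈cyclicCarlitzSeries : rhsS ≈ cyclicCarlitzSeries
rhsS≈cyclicCarlitzSeries = begin
  numerS ⊗ carlitzGF ⊕ extraS
    ≈⟨ ⊕-cong (⊗-congʳ carlitzGF numerS-closedForm) extraS-closedForm ⟩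
  (D ⊕ ⊖ E) ⊗ carlitzGF ⊕ (Xs ⊕ ⊖ D)
    ≈⟨ ⊕-congʳ (Xs ⊕ ⊖ D) (⊗-distribʳ carlitzGF D (⊖ E)) ⟩
  (D ⊗ carlitzGF ⊕ (⊖ E) ⊗ carlitzGF) ⊕ (Xs ⊕ ⊖ D)
    ≈⟨ ⊕-congʳ (Xs ⊕ ⊖ D) (⊕-congˡ (D ⊗ carlitzGF) (-‿distribˡ-* E carlitzGF)) ⟨
  (D ⊗ carlitzGF ⊕ ⊖ (E ⊗ carlitzGF)) ⊕ (Xs ⊕ ⊖ D)
    ≈⟨ coeffwise (λ n → regroup ((D ⊗ carlitzGF) n) ((E ⊗ carlitzGF) n) (Xs n) (D n)) ⟩
  (D ⊗ carlitzGF ⊕ ⊖ (D ⊕ E ⊗ carlitzGF)) ⊕ Xs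
    ≈⟨ ⊕-cong (⊕-cong (≈-trans (⊗-comm D carlitzGF) (≈-sym carlitzSeries-nonempty))
                      (⊖-cong (≈-sym firstEqualsLastSeries-closedForm)))
              (≈-sym singletonSeries-closedForm) ⟩
  (carlitzSeries (λ _ → true) ⊕ ⊖ firstEqualsLastSeries) ⊕ singletonSeries
    ≈⟨ cyclicCarlitzSeries-decomposition ⟨
  cyclicCarlitzSeries ∎
  where
  open ≈-Reasoning
  D = denomSumS
  E = squaresSum
  Xs = ΣS≥1 X^
  regroup : ∀ p e x d → (p + - e) + (x + - d) ≡ (p + - (d + e)) + x
  regroup = solve-∀

corollary5p4 : (n : ℕ) → Σ (List (List ℕ)) (λ L → Unique L × ((W : List ℕ) → (W ∈ L ⇔ (CyclicCarlitz W × sum W ≡ n))) × rhsS n ≡ + length L)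
corollary5p4 n =
  filterᵇ isCyclicCarlitz (compositions n) ,
  Unique.filter⁺ (T? ∘ isCyclicCarlitz) (compositionsFuel-unique n n) ,
  ∈-cyclicCarlitz⇔ n ,
  trans (coeff rhsS≈cyclicCarlitzSeries n) (sym (length-filterᵇ isCyclicCarlitz (compositions n)))
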